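{- Let $S$ be a solid, let $x\in S$ and let $y\in S$ with $y\ne e(y)$. Then $e(x)u(y)=e(x)$.
   Context: A solid is a set $S$ with binary operations $+$ and $\cdot$ and a relation $\le$ satisfying: (1) $+$ is associative and commutative; for every $x$ there is a unique $e$ with $x+e=x$ and $e+f=e$ whenever $x+f=x$, written $e(x)$ (the magnitude of $x$); for every $x$ there is $s$ with $x+s=e(x)$ and $e(s)=e(x)$, written $-x$; $e(x+y)=e(x)$ or $e(x+y)=e(y)$. (2) $\cdot$ is associative and commutative; for every $x\ne e(x)$ there is a unique $u$ with $xu=x$ and $uv=u$ whenever $xv=x$, written $u(x)$; for every $x\ne e(x)$ there is $d$ with $xd=u(x)$ and $u(d)=u(x)$, written $x^{ -1}$; for $x\ne e(x),y\ne e(y)$: $u(xy)=u(x)$ or $u(xy)=u(y)$. (3) $\le$ is a total order; $x\le y\Rightarrow x+z\le y+z$; $y+e(x)=e(x)\Rightarrow (y\le e(x)$ and $-y\le e(x))$; $(e(x)<x$ and $y\le z)\Rightarrow xy\le xz$; $e(y)\le y\le z\Rightarrow e(x)y\le e(x)z$. (4) For all $x,y$ there is $z$ with $e(x)y=e(z)$; $e(xy)=e(x)y+e(y)x$; for $x\ne e(x)$, $e(u(x))=e(x)x^{ -1}$; $xy+xz=x(y+z)+e(x)y+e(x)z$; $-(xy)=(-x)y$. (5) There is $0$ with $0+x=x$ for all $x$; there is $1$ with $1x=x$ for all $x$; there is $M$ with $e(x)+M=M$ for all $x$; there is $x$ with $e(x)\ne 0$ and $e(x)\ne M$; for every $x$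 there is $a$ with $x=a+e(x)$ and $e(a)=0$; if $x=e(x)$, $y=e(y)$ and $x<y$ then there is $z\ne e(z)$ with $x<z<y$. -}

module Defs where

open import Level using (Level; suc; _⊔_)
open import Relation.Binary.PropositionalEquality using (_≡_; _≢_)
open import Relation.Binary.Definitions using (Total)
open import Data.Sum using (_⊎_)
open import Data.Product using (Σ; ∃; _×_)
open import Relation.Binary.Structures using (IsTotalOrder)

-- Magnitude e(x), opposite -x, unit u(x), inverse x⁻¹ are given as operations
-- together with their defining properties (e and u are unique by their
-- defining properties, so this is no loss; for -x and x⁻¹ the operation picks
-- a witness, as the paper's notation does).
record Solid (c ℓ : Level) : Set (suc (c ⊔ ℓ)) where
  infixl 6 _+_
  infixl 7 _·_
  infix 4 _≤_ _<_
  field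
    S   : Set c
    _+_ : S → S → S
    _·_ : S → S → S
    _≤_ : S → S → Set ℓ
    +-assoc : ∀ x y z → (x + y) + z ≡ x + (y + z)
    +-comm  : ∀ x y → x + y ≡ y + x
    e       : S → S
    e-neut  : ∀ x → x + e x ≡ x
    e-min   : ∀ x f → x + f ≡ x → e x + f ≡ e x
    e-unique : ∀ x e′ → x + e′ ≡ x → (∀ f → x + f ≡ x → e′ + f ≡ e′) → e′ ≡ e x
    -_      : S → S
    neg-inv : ∀ x → x + (- x) ≡ e x
    neg-e   : ∀ x → e (- x) ≡ e x
    e-+     : ∀ x y → e (x + y) ≡ e x ⊎ e (x + y) ≡ e y
    ·-assoc : ∀ x y z → (x · y) · z ≡ x · (y · z)
    ·-comm  : ∀ x y → x · y ≡ y · x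
    u       : (x : S) → x ≢ e x → S
    u-neut  : ∀ x (p : x ≢ e x) → x · u x p ≡ x
    u-min   : ∀ x (p : x ≢ e x) v → x · v ≡ x → u x p · v ≡ u x p
    u-unique : ∀ x (p : x ≢ e x) u′ → x · u′ ≡ x → (∀ v → x · v ≡ x → u′ · v ≡ u′) → u′ ≡ u x p
    inv     : (x : S) → x ≢ e x → S
    inv-inv : ∀ x (p : x ≢ e x) → x · inv x p ≡ u x p
    inv-u   : ∀ x (p : x ≢ e x) (q : inv x p ≢ e (inv x p)) → u (inv x p) q ≡ u x p
    u-·     : ∀ x y (p : x ≢ e x) (q : y ≢ e y) (r : x · y ≢ e (x · y)) →
              u (x · y) r ≡ u x p ⊎ u (x · y) r ≡ u y q
    ≤-isTotalOrder : IsTotalOrder _≡_ _≤_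
    +-mono-≤ : ∀ x y z → x ≤ y → x + z ≤ y + z
    absorb-≤ : ∀ x y → y + e x ≡ e x → (y ≤ e x × (- y) ≤ e x)
  _<_ : S → S → Set (c ⊔ ℓ)
  x < y = x ≤ y × x ≢ y
  field
    ·-mono-≤ : ∀ x y z → e x < x → y ≤ z → x · y ≤ x · z
    e·-mono-≤ : ∀ x y z → e y ≤ y → y ≤ z → e x · y ≤ e x · z
    e·-is-e  : ∀ x y → ∃ λ z → e x · y ≡ e z
    e-·      : ∀ x y → e (x · y) ≡ e x · y + e y · x
    e-u      : ∀ x (p : x ≢ e x) → e (u x p) ≡ e x · inv x p
    distr    : ∀ x y z → x · y + x · z ≡ x · (y + z) + e x · y + e x · z
    neg-·    : ∀ x y → - (x · y) ≡ (- x) · y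
    0# : S
    +-identityˡ : ∀ x → 0# + x ≡ x
    1# : S
    ·-identityˡ : ∀ x → 1# · x ≡ x
    M : S
    M-absorb : ∀ x → e x + M ≡ M
    nontrivial : ∃ λ x → e x ≢ 0# × e x ≢ M
    decomp : ∀ x → ∃ λ a → x ≡ a + e x × e a ≡ 0#
    dense : ∀ x y → x ≡ e x → y ≡ e y → x < y →
            ∃ λ z → z ≢ e z × x < z × z < y

-- Let w be a non-magnitude with w · a = w; replacing w by -w if necessary we may
-- assume e w < w. Monotonicity of multiplication by w squeezes a: were a ≤ e a,
-- then w ≤ e a · w ≤ e w; were 1 + 1 < a or a + a < 1, then w + w ≤ w, forcing
-- w = e w. Hence e a ≤ a ≤ 1 + 1 and 1 ≤ a + a, and multiplying these by a
-- magnitude e x, which absorbs e x · (1 + 1) and e x · (a + a), gives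
-- e x · a ≤ e x ≤ e x · a.
module Submission where

open import Defs
open import Relation.Binary.PropositionalEquality using (_≡_; _≢_)
open import Relation.Binary.PropositionalEquality
  using (sym; trans; cong; cong₂; subst; subst₂; module ≡-Reasoning)
open import Relation.Binary.Structures using (IsTotalOrder)
open import Relation.Nullary using (¬_)
open import Data.Sum using (inj₁; inj₂)
open import Data.Product using (Σ; _×_; _,_; proj₁; proj₂)
open import Data.Empty using (⊥-elim)

module SolidProperties {c ℓ} (𝕊 : Solid c ℓ) where
  open Solid 𝕊
  open IsTotalOrder ≤-isTotalOrder using (total; antisym) renaming (trans to ≤-trans)
  open ≡-Reasoning

  ·-identityʳ : ∀ a → a · 1# ≡ a
  ·-identityʳ a = trans (·-comm a 1#) (·-identityˡ a)

  idem⇒≡e : ∀ z → z + z ≡ z → z ≡ e z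
  idem⇒≡e z zz≡z = e-unique z z zz≡z (λ _ zf≡z → zf≡z)

  e-idem : ∀ x → e x + e x ≡ e x
  e-idem x = e-min x (e x) (e-neut x)

  e-e : ∀ x → e (e x) ≡ e x
  e-e x = sym (idem⇒≡e (e x) (e-idem x))

  e·-idem : ∀ x a → e x · a + e x · a ≡ e x · a
  e·-idem x a with e·-is-e x a
  ... | z , eq rewrite eq = e-idem z

  idem⇒absorbed⇒≤ : ∀ {y z} → z + z ≡ z → y + z ≡ z → y ≤ z
  idem⇒absorbed⇒≤ {y} {z} zz≡z yz≡z =
    subst (y ≤_) (sym z≡ez) (proj₁ (absorb-≤ z y (subst (λ t → y + t ≡ t) z≡ez yz≡z)))
    where z≡ez = idem⇒≡e z zz≡z

  idem-summand-absorbed : ∀ {p q z} → z ≡ p + q → p + p ≡ p → p + z ≡ z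
  idem-summand-absorbed {p} {q} {z} z≡p+q pp≡p = begin
    p + z        ≡⟨ cong (p +_) z≡p+q ⟩
    p + (p + q)  ≡⟨ sym (+-assoc p p q) ⟩
    (p + p) + q  ≡⟨ cong (_+ q) pp≡p ⟩
    p + q        ≡⟨ sym z≡p+q ⟩
    z            ∎

  absorbed-by-e⇒absorbed : ∀ {x y} → y + e x ≡ e x → x + y ≡ x
  absorbed-by-e⇒absorbed {x} {y} y+ex≡ex = begin
    x + y          ≡⟨ cong (_+ y) (sym (e-neut x)) ⟩
    x + e x + y    ≡⟨ +-assoc x (e x) y ⟩
    x + (e x + y)  ≡⟨ cong (x +_) (trans (+-comm (e x) y) y+ex≡ex) ⟩
    x + e x        ≡⟨ e-neut x ⟩
    x              ∎

  ·-double : ∀ x a → x · a + x · a ≡ x · (a + a) + e x · a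
  ·-double x a = begin
    x · a + x · a                        ≡⟨ distr x a a ⟩
    x · (a + a) + e x · a + e x · a      ≡⟨ +-assoc _ _ _ ⟩
    x · (a + a) + (e x · a + e x · a)    ≡⟨ cong (x · (a + a) +_) (e·-idem x a) ⟩
    x · (a + a) + e x · a                ∎

  +-double : ∀ x → x + x ≡ x · (1# + 1#) + e x
  +-double x = begin
    x + x                       ≡⟨ sym (cong₂ _+_ (·-identityʳ x) (·-identityʳ x)) ⟩
    x · 1# + x · 1#             ≡⟨ ·-double x 1# ⟩
    x · (1# + 1#) + e x · 1#    ≡⟨ cong (x · (1# + 1#) +_) (·-identityʳ (e x)) ⟩
    x · (1# + 1#) + e x         ∎

  e·-double-absorbed : ∀ x a → e x · (a + a) + e x · a ≡ e x · a
  e·-double-absorbed x a = begin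
    e x · (a + a) + e x · a        ≡⟨ cong (λ t → e x · (a + a) + t · a) (sym (e-e x)) ⟩
    e x · (a + a) + e (e x) · a    ≡⟨ sym (·-double (e x) a) ⟩
    e x · a + e x · a              ≡⟨ e·-idem x a ⟩
    e x · a                        ∎

  e·-double≤e : ∀ x → e x · (1# + 1#) ≤ e x
  e·-double≤e x = idem⇒absorbed⇒≤ (e-idem x) (begin
    e x · (1# + 1#) + e x      ≡⟨ cong (e x · (1# + 1#) +_) (sym (e-e x)) ⟩
    e x · (1# + 1#) + e (e x)  ≡⟨ sym (+-double (e x)) ⟩
    e x + e x                  ≡⟨ e-idem x ⟩
    e x                        ∎)

  e<⇒double≰ : ∀ {w} → e w < w → ¬ (w + w ≤ w)
  e<⇒double≰ {w} (ew≤w , ew≢w) ww≤w = ew≢w (sym (idem⇒≡e w (antisym ww≤w w≤ww)))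
    where
    w≤ww : w ≤ w + w
    w≤ww = subst (_≤ w + w) (trans (+-comm (e w) w) (e-neut w)) (+-mono-≤ (e w) w w ew≤w)

  double≤ : ∀ {w b c} → w · b ≤ w → w + c ≡ w → w + w ≡ w · b + c → w + w ≤ w
  double≤ {w} {b} {c} wb≤w wc≡w ww≡wb+c =
    subst₂ _≤_ (sym ww≡wb+c) wc≡w (+-mono-≤ (w · b) w c wb≤w)

  stabiliser-e≤ : ∀ {w a} → e w < w → w · a ≡ w → e a ≤ a
  stabiliser-e≤ {w} {a} e<w wa≡w with total (e a) a
  ... | inj₁ ea≤a = ea≤a
  ... | inj₂ a≤ea = ⊥-elim (proj₂ e<w (antisym (proj₁ e<w) (≤-trans w≤ea·w ea·w≤ew)))
    where
    w≤ea·w : w ≤ e a · w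
    w≤ea·w = subst₂ _≤_ wa≡w (·-comm w (e a)) (·-mono-≤ w a (e a) e<w a≤ea)
    ea·w≤ew : e a · w ≤ e w
    ea·w≤ew = idem⇒absorbed⇒≤ (e-idem w) (idem-summand-absorbed
      (trans (cong e (sym wa≡w)) (trans (e-· w a) (+-comm _ _))) (e·-idem a w))

  module Stabiliser (w a : S) (e<w : e w < w) (wa≡w : w · a ≡ w) where

    private
      B : S
      B = e w · a

      ew≡B+ea·w : e w ≡ B + e a · w
      ew≡B+ea·w = trans (cong e (sym wa≡w)) (e-· w a)

    ≤1+1 : a ≤ 1# + 1#
    ≤1+1 with total a (1# + 1#)
    ... | inj₁ a≤2 = a≤2
    ... | inj₂ 2≤a = ⊥-elim (e<⇒double≰ e<w (double≤ w2≤w (e-neut w) (+-double w)))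
      where
      w2≤w : w · (1# + 1#) ≤ w
      w2≤w = subst (w · (1# + 1#) ≤_) wa≡w (·-mono-≤ w (1# + 1#) a e<w 2≤a)

    1≤+ : 1# ≤ a + a
    1≤+ with total 1# (a + a)
    ... | inj₁ 1≤2a = 1≤2a
    ... | inj₂ 2a≤1 = ⊥-elim (e<⇒double≰ e<w (double≤ w2a≤w wB≡w ww≡w2a+B))
      where
      w2a≤w : w · (a + a) ≤ w
      w2a≤w = subst (w · (a + a) ≤_) (·-identityʳ w) (·-mono-≤ w (a + a) 1# e<w 2a≤1)
      wB≡w : w + B ≡ w
      wB≡w = absorbed-by-e⇒absorbed (idem-summand-absorbed ew≡B+ea·w (e·-idem w a))
      ww≡w2a+B : w + w ≡ w · (a + a) + B
      ww≡w2a+B = trans (sym (cong₂ _+_ wa≡w wa≡w)) (·-double w a)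

    fixes-magnitudes : ∀ x → e x · a ≡ e x
    fixes-magnitudes x = antisym
      (≤-trans (e·-mono-≤ x a (1# + 1#) (stabiliser-e≤ e<w wa≡w) ≤1+1) (e·-double≤e x))
      (≤-trans (subst (_≤ e x · (a + a)) (·-identityʳ (e x)) (e·-mono-≤ x 1# (a + a) e1≤1 1≤+))
               (idem⇒absorbed⇒≤ (e·-idem x a) (e·-double-absorbed x a)))
      where
      e1≤1 : e 1# ≤ 1#
      e1≤1 = stabiliser-e≤ e<w (·-identityʳ w)

  stabilised-positive : ∀ y (p : y ≢ e y) → Σ S λ w → e w < w × w · u y p ≡ w
  stabilised-positive y p with total (e y) y
  ... | inj₁ ey≤y = y , (ey≤y , λ ey≡y → p (sym ey≡y)) , u-neut y p
  ... | inj₂ y≤ey = - y , (e-y≤-y , e-y≢-y) , -y·u≡-y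
    where
    ey+-y≡-y : e y + (- y) ≡ - y
    ey+-y≡-y = trans (+-comm (e y) (- y)) (trans (cong ((- y) +_) (sym (neg-e y))) (e-neut (- y)))
    e-y≤-y : e (- y) ≤ - y
    e-y≤-y = subst₂ _≤_ (trans (neg-inv y) (sym (neg-e y))) ey+-y≡-y (+-mono-≤ y (e y) (- y) y≤ey)
    e-y≢-y : e (- y) ≢ - y
    e-y≢-y e-y≡-y = p (begin
      y           ≡⟨ sym (e-neut y) ⟩
      y + e y     ≡⟨ cong (y +_) (trans (sym (neg-e y)) e-y≡-y) ⟩
      y + (- y)   ≡⟨ neg-inv y ⟩
      e y         ∎)
    -y·u≡-y : (- y) · u y p ≡ - y
    -y·u≡-y = trans (sym (neg-· y (u y p))) (cong -_ (u-neut y p))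

theorem4p15 : ∀ {c ℓ} (𝕊 : Solid c ℓ) → let open Solid 𝕊 in
    ∀ (x y : S) (p : y ≢ e y) → e x · u y p ≡ e x
theorem4p15 𝕊 x y p with SolidProperties.stabilised-positive 𝕊 y p
... | w , e<w , wu≡w = SolidProperties.Stabiliser.fixes-magnitudes 𝕊 w _ e<w wu≡w x
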